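{- Let $\mathcal{G}$ be a finite simple graph with vertex set $\mathcal{V}$. Then $EQDM(\mathcal{I}(\mathcal{G}))=ESS(\mathcal{I}(\mathcal{G}))$.
   Context: $\mathcal{O}(x)$ denotes the orbit of $x$ under $\mathrm{Aut}(\mathcal{G})$. For $\mathcal{A}\subseteq\mathcal{V}$, $x\equiv_{\mathcal{A}}y$ iff $\mathcal{O}(x)\cap\mathcal{A}=\mathcal{O}(y)\cap\mathcal{A}$, and $\gamma_{\mathcal{A}}(\mathcal{G})$ is the partition of $\mathcal{V}$ into the equivalence classes of $\equiv_{\mathcal{A}}$. A subset $\mathcal{S}\subseteq\mathcal{V}$ is $\mathcal{I}$-essential if $\gamma_{\mathcal{V}\setminus\mathcal{S}}(\mathcal{G})\neq\gamma_{\mathcal{V}}(\mathcal{G})$ and $\gamma_{\mathcal{V}\setminus\mathcal{Q}}(\mathcal{G})=\gamma_{\mathcal{V}}(\mathcal{G})$ for every proper subset $\mathcal{Q}\subsetneq\mathcal{S}$; $ESS(\mathcal{I}(\mathcal{G}))$ is the family of all $\mathcal{I}$-essential sets. The discernibility matrix of $\mathcal{G}$ is the $|\mathcal{V}|\times|\mathcal{V}|$ matrix with entries $\Delta_{\mathcal{G}}(x_i,x_j)=\mathcal{O}(x_i)\cup\mathcal{O}(x_j)$ if $x_i\notin\mathcal{O}(x_j)$ and $\Delta_{\mathcal{G}}(x_i,x_j)=\emptyset$ if $x_i\in\mathcal{O}(x_j)$. $EQDM(\mathcal{I}(\mathcal{G}))$ is the collection of all distinct nonempty entries of this matrix (equivalently,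 the sets $\mathcal{O}_i\cup\mathcal{O}_j$ for distinct orbits $\mathcal{O}_i\neq\mathcal{O}_j$ of $\mathcal{G}$). -}

module Defs where

open import Data.Nat using (ℕ)
open import Data.Bool using (Bool; false)
open import Data.Fin using (Fin)
open import Data.Fin.Subset using (Subset; _∈_; _⊂_; ∁)
open import Data.Fin.Permutation using (Permutation′; _⟨$⟩ʳ_)
open import Data.Product using (Σ; ∃; ∃₂; _×_)
open import Data.Sum using (_⊎_)
open import Relation.Nullary using (¬_)
open import Relation.Binary.PropositionalEquality using (_≡_)
open import Function.Bundles using (_⇔_)

record SimpleGraph (n : ℕ) : Set where
  field
    adj   : Fin n → Fin n → Bool
    sym   : ∀ u v → adj u v ≡ adj v u
    loopless : ∀ v → adj v v ≡ false
open SimpleGraph public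

IsAutomorphism : ∀ {n} → SimpleGraph n → Permutation′ n → Set
IsAutomorphism G σ = ∀ u v → adj G (σ ⟨$⟩ʳ u) (σ ⟨$⟩ʳ v) ≡ adj G u v

Aut : ∀ {n} → SimpleGraph n → Set
Aut {n} G = Σ (Permutation′ n) (IsAutomorphism G)

InOrbit : ∀ {n} → SimpleGraph n → Fin n → Fin n → Set
InOrbit G x y = ∃ λ (σ : Aut G) → Σ.proj₁ σ ⟨$⟩ʳ x ≡ y

EquivOn : ∀ {n} → SimpleGraph n → Subset n → Fin n → Fin n → Set
EquivOn G A x y = ∀ z → z ∈ A → (InOrbit G x z ⇔ InOrbit G y z)

-- γ_𝒜(G) = γ_𝒱(G): the two partitions into equivalence classes coincide,
-- i.e. the equivalence relations ≡_𝒜 and ≡_𝒱 coincide.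
SamePartition : ∀ {n} → SimpleGraph n → Subset n → Subset n → Set
SamePartition G A B = ∀ x y → (EquivOn G A x y ⇔ EquivOn G B x y)

IsEssential : ∀ {n} → SimpleGraph n → Subset n → Set
IsEssential G S =
  ¬ SamePartition G (∁ S) Data.Fin.Subset.⊤
  × (∀ Q → Q ⊂ S → SamePartition G (∁ Q) Data.Fin.Subset.⊤)

IsDiscernEntry : ∀ {n} → SimpleGraph n → Subset n → Set
IsDiscernEntry G S =
  ∃₂ λ xi xj → ¬ InOrbit G xj xi
    × (∀ z → z ∈ S ⇔ (InOrbit G xi z ⊎ InOrbit G xj z))

{-# OPTIONS --safe #-}
-- Only two facts about orbits matter: they are the classes of an equivalence relation,
-- and membership is decidable (automorphisms of a finite graph can be searched for).
-- Removing S merges x and y exactly when their classes agree outside S, so the partition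
-- is unchanged iff S contains no two distinct whole classes.  A set that contains two
-- distinct classes [x], [y] and is minimal with this property must equal [x] ∪ [y], since
-- any further point could be dropped; conversely in [x] ∪ [y] any two distinct whole classes
-- are [x] and [y] again, so no proper subset contains two.
module Submission where

open import Level using (Level)
open import Data.Nat using (ℕ; zero; suc)
import Data.Bool.Properties as Bool
open import Data.Fin using (Fin)
open import Data.Fin.Properties using (any?; all?) renaming (_≟_ to _≟ᶠ_)
open import Data.Fin.Subset using (Subset; _∈_; _⊂_; ∁; ⊤; _-_)
open import Data.Fin.Subset.Properties
  using (_∈?_; ∈⊤; x∈∁p⇒x∉p; x∉p⇒x∈∁p; x∈p∧x≢y⇒x∈p-y; x∈p⇒p-x⊂p)
open import Data.Fin.Permutation using (permutation; _⟨$⟩ʳ_; _⟨$⟩ˡ_; inverseˡ; inverseʳ; id; flip; _∘ₚ_)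
open import Data.Vec.Functional using (_∷_; head; tail)
open import Data.Vec.Functional.Properties using (∷-cong)
open import Data.Product using (∃; ∃₂; _×_; _,_)
open import Data.Sum using (_⊎_; inj₁; inj₂; [_,_]; swap) renaming (map to ⊎-map)
open import Data.Empty using (⊥-elim)
open import Function using (_∘_)
open import Function.Bundles using (_⇔_; mk⇔; Equivalence)
import Function.Properties.Equivalence as ⇔
open import Relation.Nullary using (¬_; Dec; yes; no)
open import Relation.Nullary.Decidable using (map′; _×-dec_; _→-dec_; ¬?)
open import Relation.Unary using (Pred; Decidable)
open import Relation.Binary.Core using (Rel)
open import Relation.Binary.Definitions using (_Respects_)
open import Relation.Binary.Structures using (IsDecEquivalence)
open import Relation.Binary.PropositionalEquality
  using (_≡_; _≗_; refl; sym; trans; cong; cong₂; subst; module ≡-Reasoning)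

open import Defs using (SimpleGraph; adj; InOrbit; IsEssential; IsDiscernEntry)

private
  variable
    p : Level
    m k : ℕ

anyFun? : {P : Pred (Fin m → Fin k) p} → P Respects _≗_ → Decidable P → Dec (∃ P)
anyFun? {zero}  resp P? = map′ (_ ,_) (λ (f , Pf) → resp (λ ()) Pf) (P? λ ())
anyFun? {suc m} resp P? =
  map′ (λ (b , g , Pbg) → b ∷ g , Pbg)
       (λ (f , Pf) → head f , tail f , resp (∷-cong refl λ _ → refl) Pf)
       (any? λ b → anyFun? (resp ∘ ∷-cong refl) (P? ∘ (b ∷_)))

module _ {n : ℕ} (G : SimpleGraph n) where

  PreservesAdj : (Fin n → Fin n) → Set
  PreservesAdj f = ∀ u v → adj G (f u) (f v) ≡ adj G u v

  IsAutPairSending : Fin n → Fin n → (Fin n → Fin n) → (Fin n → Fin n) → Set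
  IsAutPairSending x y f g =
    (∀ v → f (g v) ≡ v) × (∀ u → g (f u) ≡ u) × PreservesAdj f × f x ≡ y

  isAutPairSending-cong : ∀ {x y f f′ g g′} → f ≗ f′ → g ≗ g′ →
                          IsAutPairSending x y f g → IsAutPairSending x y f′ g′
  isAutPairSending-cong {x} {y} {f} {f′} {g} {g′} f≗f′ g≗g′ (fg≗id , gf≗id , pres , fx≡y) =
    fg′≗id , gf′≗id , pres′ , trans (sym (f≗f′ x)) fx≡y
    where
    open ≡-Reasoning
    fg′≗id : ∀ v → f′ (g′ v) ≡ v
    fg′≗id v = begin
      f′ (g′ v) ≡⟨ sym (f≗f′ (g′ v)) ⟩
      f (g′ v)  ≡⟨ cong f (sym (g≗g′ v)) ⟩
      f (g v)   ≡⟨ fg≗id v ⟩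
      v         ∎
    gf′≗id : ∀ u → g′ (f′ u) ≡ u
    gf′≗id u = begin
      g′ (f′ u) ≡⟨ sym (g≗g′ (f′ u)) ⟩
      g (f′ u)  ≡⟨ cong g (sym (f≗f′ u)) ⟩
      g (f u)   ≡⟨ gf≗id u ⟩
      u         ∎
    pres′ : PreservesAdj f′
    pres′ u v = trans (sym (cong₂ (adj G) (f≗f′ u) (f≗f′ v))) (pres u v)

  isAutPairSending? : ∀ x y f g → Dec (IsAutPairSending x y f g)
  isAutPairSending? x y f g =
    all? (λ v → f (g v) ≟ᶠ v) ×-dec all? (λ u → g (f u) ≟ᶠ u)
      ×-dec all? (λ u → all? λ v → adj G (f u) (f v) Bool.≟ adj G u v) ×-dec f x ≟ᶠ y

  inOrbit⇔autPair : ∀ {x y} → InOrbit G x y ⇔ ∃₂ (IsAutPairSending x y)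
  inOrbit⇔autPair = mk⇔
    (λ ((σ , pres) , σx≡y) → (σ ⟨$⟩ʳ_) , (σ ⟨$⟩ˡ_) , (λ _ → inverseʳ σ) , (λ _ → inverseˡ σ) , pres , σx≡y)
    (λ (f , g , fg≗id , gf≗id , pres , fx≡y) → (permutation f g fg≗id gf≗id , pres) , fx≡y)

  inOrbit? : ∀ x y → Dec (InOrbit G x y)
  inOrbit? x y = map′ (Equivalence.from inOrbit⇔autPair) (Equivalence.to inOrbit⇔autPair)
    (anyFun? (λ f≗f′ (g , pair) → g , isAutPairSending-cong f≗f′ (λ _ → refl) pair)
             (λ f → anyFun? (isAutPairSending-cong (λ _ → refl)) (isAutPairSending? x y f)))

  inOrbit-isDecEquivalence : IsDecEquivalence (InOrbit G)
  inOrbit-isDecEquivalence = record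
    { isEquivalence = record
      { refl  = (id , λ _ _ → refl) , refl
      ; sym   = λ { ((σ , pres) , σx≡y) →
                  (flip σ , λ u v → trans (sym (pres _ _)) (cong₂ (adj G) (inverseʳ σ) (inverseʳ σ)))
                  , trans (cong (σ ⟨$⟩ˡ_) (sym σx≡y)) (inverseˡ σ) }
      ; trans = λ { ((σ , presσ) , σx≡y) ((τ , presτ) , τy≡z) →
                  (σ ∘ₚ τ , λ u v → trans (presτ _ _) (presσ u v)) , trans (cong (τ ⟨$⟩ʳ_) σx≡y) τy≡z }
      }
    ; _≟_ = inOrbit?
    }

module ClassTraces {n ℓ} {_∼_ : Rel (Fin n) ℓ} (∼-isDecEquivalence : IsDecEquivalence _∼_) where

  open IsDecEquivalence ∼-isDecEquivalence
    renaming (refl to ∼-refl; sym to ∼-sym; trans to ∼-trans; _≟_ to _∼?_)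

  -- For _∼_ = InOrbit G these four notions unfold to EquivOn, SamePartition,
  -- IsEssential and IsDiscernEntry.
  TracesAgreeOn : Subset n → Fin n → Fin n → Set ℓ
  TracesAgreeOn A x y = ∀ z → z ∈ A → (x ∼ z ⇔ y ∼ z)

  SameTraceRelation : Subset n → Subset n → Set ℓ
  SameTraceRelation A B = ∀ x y → (TracesAgreeOn A x y ⇔ TracesAgreeOn B x y)

  IsEssentialSet : Subset n → Set ℓ
  IsEssentialSet S =
    ¬ SameTraceRelation (∁ S) ⊤ × (∀ Q → Q ⊂ S → SameTraceRelation (∁ Q) ⊤)

  IsUnionOfTwoClasses : Subset n → Set ℓ
  IsUnionOfTwoClasses S = ∃₂ λ x y → ¬ y ∼ x × (∀ z → z ∈ S ⇔ (x ∼ z ⊎ y ∼ z))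

  [_]⊆_ : Fin n → Subset n → Set ℓ
  [ x ]⊆ S = ∀ z → x ∼ z → z ∈ S

  [_]⊆?_ : ∀ x S → Dec ([ x ]⊆ S)
  [ x ]⊆? S = all? λ z → x ∼? z →-dec z ∈? S

  ContainsTwoClasses : Subset n → Set ℓ
  ContainsTwoClasses S = ∃₂ λ x y → ¬ x ∼ y × [ x ]⊆ S × [ y ]⊆ S

  containsTwoClasses? : ∀ S → Dec (ContainsTwoClasses S)
  containsTwoClasses? S =
    any? λ x → any? λ y → ¬? (x ∼? y) ×-dec [ x ]⊆? S ×-dec [ y ]⊆? S

  ∼⇒tracesAgreeOn : ∀ {A x y} → x ∼ y → TracesAgreeOn A x y
  ∼⇒tracesAgreeOn x∼y _ _ = mk⇔ (∼-trans (∼-sym x∼y)) (∼-trans x∼y)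

  tracesAgreeOn-sym : ∀ {A x y} → TracesAgreeOn A x y → TracesAgreeOn A y x
  tracesAgreeOn-sym agree z z∈A = ⇔.sym (agree z z∈A)

  tracesAgreeOn∁⇒[]⊆ : ∀ {S x y} → ¬ x ∼ y → TracesAgreeOn (∁ S) x y → [ x ]⊆ S
  tracesAgreeOn∁⇒[]⊆ {S} x≁y agree z x∼z with z ∈? S
  ... | yes z∈S = z∈S
  ... | no  z∉S = ⊥-elim (x≁y (∼-trans x∼z (∼-sym (Equivalence.to (agree z (x∉p⇒x∈∁p z∉S)) x∼z))))

  sameTraceRelation∁⇔¬containsTwoClasses :
    ∀ S → SameTraceRelation (∁ S) ⊤ ⇔ (¬ ContainsTwoClasses S)
  sameTraceRelation∁⇔¬containsTwoClasses S = mk⇔ noTwo sameTraces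
    where
    noTwo : SameTraceRelation (∁ S) ⊤ → ¬ ContainsTwoClasses S
    noTwo same (x , y , x≁y , [x]⊆S , [y]⊆S) =
      x≁y (∼-sym (Equivalence.to (Equivalence.to (same x y) agreeOn∁ x ∈⊤) ∼-refl))
      where
      agreeOn∁ : TracesAgreeOn (∁ S) x y
      agreeOn∁ z z∈∁S = mk⇔ (⊥-elim ∘ x∈∁p⇒x∉p z∈∁S ∘ [x]⊆S z)
                              (⊥-elim ∘ x∈∁p⇒x∉p z∈∁S ∘ [y]⊆S z)
    sameTraces : ¬ ContainsTwoClasses S → SameTraceRelation (∁ S) ⊤
    sameTraces noTwo x y = mk⇔ extend (λ agree z _ → agree z ∈⊤)
      where
      extend : TracesAgreeOn (∁ S) x y → TracesAgreeOn ⊤ x y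
      extend agree with x ∼? y
      ... | yes x∼y = ∼⇒tracesAgreeOn x∼y
      ... | no  x≁y = ⊥-elim (noTwo (x , y , x≁y , tracesAgreeOn∁⇒[]⊆ x≁y agree ,
                                     tracesAgreeOn∁⇒[]⊆ (x≁y ∘ ∼-sym) (tracesAgreeOn-sym agree)))

  [x]∪[y]⊆[a]∪[b] : ∀ {a b x y z} → ¬ a ∼ b → x ∼ a ⊎ y ∼ a → x ∼ b ⊎ y ∼ b →
                    x ∼ z ⊎ y ∼ z → a ∼ z ⊎ b ∼ z
  [x]∪[y]⊆[a]∪[b] a≁b (inj₁ x∼a) (inj₁ x∼b) _ = ⊥-elim (a≁b (∼-trans (∼-sym x∼a) x∼b))
  [x]∪[y]⊆[a]∪[b] a≁b (inj₂ y∼a) (inj₂ y∼b) _ = ⊥-elim (a≁b (∼-trans (∼-sym y∼a) y∼b))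
  [x]∪[y]⊆[a]∪[b] _   (inj₁ x∼a) (inj₂ y∼b) =
    ⊎-map (∼-trans (∼-sym x∼a)) (∼-trans (∼-sym y∼b))
  [x]∪[y]⊆[a]∪[b] _   (inj₂ y∼a) (inj₁ x∼b) =
    ⊎-map (∼-trans (∼-sym y∼a)) (∼-trans (∼-sym x∼b)) ∘ swap

  []⊆-remove : ∀ {x z S} → [ x ]⊆ S → ¬ x ∼ z → [ x ]⊆ (S - z)
  []⊆-remove [x]⊆S x≁z w x∼w = x∈p∧x≢y⇒x∈p-y ([x]⊆S w x∼w) (λ w≡z → x≁z (subst (_ ∼_) w≡z x∼w))

  unionOfTwoClasses⇒essential : ∀ {S} → IsUnionOfTwoClasses S → IsEssentialSet S
  unionOfTwoClasses⇒essential {S} (x , y , y≁x , S⇔) =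
    (λ same → Equivalence.to (sameTraceRelation∁⇔¬containsTwoClasses S) same twoInS) ,
    λ Q Q⊂S → Equivalence.from (sameTraceRelation∁⇔¬containsTwoClasses Q) (noTwoIn Q Q⊂S)
    where
    twoInS : ContainsTwoClasses S
    twoInS = x , y , y≁x ∘ ∼-sym , (λ z → Equivalence.from (S⇔ z) ∘ inj₁)
                                  , (λ z → Equivalence.from (S⇔ z) ∘ inj₂)
    noTwoIn : ∀ Q → Q ⊂ S → ¬ ContainsTwoClasses Q
    noTwoIn Q (Q⊆S , w , w∈S , w∉Q) (a , b , a≁b , [a]⊆Q , [b]⊆Q) =
      w∉Q ([ [a]⊆Q w , [b]⊆Q w ] ([x]∪[y]⊆[a]∪[b] a≁b (inS a [a]⊆Q) (inS b [b]⊆Q)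
                                                  (Equivalence.to (S⇔ w) w∈S)))
      where
      inS : ∀ c → [ c ]⊆ Q → x ∼ c ⊎ y ∼ c
      inS c [c]⊆Q = Equivalence.to (S⇔ c) (Q⊆S ([c]⊆Q c ∼-refl))

  essential⇒unionOfTwoClasses : ∀ {S} → IsEssentialSet S → IsUnionOfTwoClasses S
  essential⇒unionOfTwoClasses {S} (notSame , minimal) with containsTwoClasses? S
  ... | no  noTwo = ⊥-elim (notSame (Equivalence.from (sameTraceRelation∁⇔¬containsTwoClasses S) noTwo))
  ... | yes (a , b , a≁b , [a]⊆S , [b]⊆S) =
    a , b , a≁b ∘ ∼-sym , λ z → mk⇔ (inClasses z) [ [a]⊆S z , [b]⊆S z ]
    where
    inClasses : ∀ z → z ∈ S → a ∼ z ⊎ b ∼ z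
    inClasses z z∈S with a ∼? z | b ∼? z
    ... | yes a∼z | _       = inj₁ a∼z
    ... | no  _   | yes b∼z = inj₂ b∼z
    ... | no  a≁z | no  b≁z =
      ⊥-elim (Equivalence.to (sameTraceRelation∁⇔¬containsTwoClasses (S - z))
                (minimal (S - z) (x∈p⇒p-x⊂p z∈S))
                (a , b , a≁b , []⊆-remove [a]⊆S a≁z , []⊆-remove [b]⊆S b≁z))

  unionOfTwoClasses⇔essential : ∀ S → IsUnionOfTwoClasses S ⇔ IsEssentialSet S
  unionOfTwoClasses⇔essential S = mk⇔ unionOfTwoClasses⇒essential essential⇒unionOfTwoClasses

proposition3p2p2 : (n : ℕ) (G : SimpleGraph n) (S : Subset n) →
    IsDiscernEntry G S ⇔ IsEssential G S
proposition3p2p2 n G S = ClassTraces.unionOfTwoClasses⇔essential (inOrbit-isDecEquivalence G) S
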